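{- Let $\Gamma$ be a connected $(G,2)$-geodesic-transitive graph of girth at least $4$, where $G\le\mathrm{Aut}(\Gamma)$. Let $N$ be an intransitive normal subgroup of $G$ with at least $3$ orbits on $V(\Gamma)$. Then $\Gamma_N$ is a complete graph if and only if $\Gamma_N$ has girth $3$.
   Context: All graphs are finite, simple, undirected. A $2$-geodesic is a path $(v_0,v_1,v_2)$ with $d(v_0,v_2)=2$; $\Gamma$ is $(G,2)$-geodesic-transitive if it has a $2$-geodesic and $G$ is transitive on vertices, on arcs and on $2$-geodesics. For $N\trianglelefteq G$, $\Gamma_N$ has the $N$-orbits as vertices, two orbits adjacent iff some of their elements are adjacent in $\Gamma$. -}

module Defs where

open import Data.Nat using (ℕ)
open import Level using (0ℓ)
open import Data.Fin using (Fin)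
open import Data.Product using (Σ; ∃; _×_; _,_)
open import Relation.Nullary using (¬_; Dec)
open import Relation.Binary.PropositionalEquality using (_≡_)
open import Relation.Unary using (Pred; _⊆_; _∈_)
open import Function using (_∘_)

record Graph (n : ℕ) : Set₁ where
  field
    _~_    : Fin n → Fin n → Set
    ~-dec  : ∀ u v → Dec (u ~ v)
    ~-sym  : ∀ {u v} → u ~ v → v ~ u
    ~-irr  : ∀ {u} → ¬ (u ~ u)
open Graph public

record Perm (n : ℕ) : Set where
  field
    to      : Fin n → Fin n
    from    : Fin n → Fin n
    to-from : ∀ x → to (from x) ≡ x
    from-to : ∀ x → from (to x) ≡ x
open Perm public

idPerm : ∀ {n} → Perm n
idPerm = record { to = λ x → x ; from = λ x → x
                ; to-from = λ _ → Relation.Binary.PropositionalEquality.refl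
                ; from-to = λ _ → Relation.Binary.PropositionalEquality.refl }

_∘ₚ_ : ∀ {n} → Perm n → Perm n → Perm n
g ∘ₚ h = record
  { to = to g ∘ to h ; from = from h ∘ from g
  ; to-from = λ x → trans (cong (to g) (to-from h (from g x))) (to-from g x)
  ; from-to = λ x → trans (cong (from h) (from-to g (to h x))) (from-to h x) }
  where open Relation.Binary.PropositionalEquality using (trans; cong)

_⁻¹ₚ : ∀ {n} → Perm n → Perm n
g ⁻¹ₚ = record { to = from g ; from = to g ; to-from = from-to g ; from-to = to-from g }

record IsSubgroup {n : ℕ} (H : Pred (Perm n) 0ℓ) : Set where
  field
    id-∈   : idPerm ∈ H
    ∘-∈    : ∀ {g h} → g ∈ H → h ∈ H → (g ∘ₚ h) ∈ H
    ⁻¹-∈   : ∀ {g} → g ∈ H → (g ⁻¹ₚ) ∈ H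
    resp   : ∀ {g h} → (∀ x → to g x ≡ to h x) → g ∈ H → h ∈ H

IsAut : ∀ {n} → Graph n → Perm n → Set
IsAut Γ g = ∀ u v → (_~_ Γ u v → _~_ Γ (to g u) (to g v))
                  × (_~_ Γ (to g u) (to g v) → _~_ Γ u v)

IsNormalSubgroup : ∀ {n} → Pred (Perm n) 0ℓ → Pred (Perm n) 0ℓ → Set
IsNormalSubgroup N G = IsSubgroup N × (N ⊆ G)
  × (∀ {g h} → g ∈ G → h ∈ N → ((g ∘ₚ h) ∘ₚ (g ⁻¹ₚ)) ∈ N)

module _ {n : ℕ} (Γ : Graph n) where
  private _≈_ = _~_ Γ

  data Walk : Fin n → Fin n → Set where
    here : ∀ {u} → Walk u u
    step : ∀ {u v w} → u ≈ v → Walk v w → Walk u w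

  Connected : Set
  Connected = ∀ u v → Walk u v

  -- girth at least 4 (no 3-cycles; acyclic graphs have girth ∞)
  TriangleFree : Set
  TriangleFree = ∀ u v w → u ≈ v → v ≈ w → w ≈ u → Data.Empty.⊥
    where import Data.Empty

  -- 2-geodesic (v0,v1,v2): path with d(v0,v2) = 2
  Is2Geodesic : Fin n → Fin n → Fin n → Set
  Is2Geodesic a b c = (a ≈ b) × (b ≈ c) × ¬ (a ≡ c) × ¬ (a ≈ c)

  Is2GeodesicTransitive : Pred (Perm n) 0ℓ → Set
  Is2GeodesicTransitive G =
      (∃ λ a → ∃ λ b → ∃ λ c → Is2Geodesic a b c)
    × (∀ u v → ∃ λ g → g ∈ G × to g u ≡ v)
    × (∀ u v u' v' → u ≈ v → u' ≈ v' →
         ∃ λ g → g ∈ G × to g u ≡ u' × to g v ≡ v')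
    × (∀ a b c a' b' c' → Is2Geodesic a b c → Is2Geodesic a' b' c' →
         ∃ λ g → g ∈ G × to g a ≡ a' × to g b ≡ b' × to g c ≡ c')

  module Quotient (N : Pred (Perm n) 0ℓ) where
    SameOrbit : Fin n → Fin n → Set
    SameOrbit u v = ∃ λ g → g ∈ N × to g u ≡ v

    QAdj : Fin n → Fin n → Set
    QAdj u v = ¬ SameOrbit u v
             × (∃ λ u' → ∃ λ v' → SameOrbit u u' × SameOrbit v v' × u' ≈ v')

    Intransitive : Set
    Intransitive = ∃ λ u → ∃ λ v → ¬ SameOrbit u v

    AtLeast3Orbits : Set
    AtLeast3Orbits = ∃ λ u → ∃ λ v → ∃ λ w →
      ¬ SameOrbit u v × ¬ SameOrbit v w × ¬ SameOrbit u w

    QuotientComplete : Set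
    QuotientComplete = ∀ u v → ¬ SameOrbit u v → QAdj u v

    -- Γ_N has girth 3: it contains a triangle (three pairwise adjacent orbits,
    -- necessarily pairwise distinct)
    QuotientGirth3 : Set
    QuotientGirth3 = ∃ λ u → ∃ λ v → ∃ λ w → QAdj u v × QAdj v w × QAdj w u

-- A triangle of Γ_N lifts, after moving its outer vertices inside their orbits, to a
-- 2-geodesic (a, b, c) of Γ (triangle-freeness of Γ makes a and c non-adjacent) whose
-- ends lie in adjacent N-orbits. Since G is transitive on 2-geodesics and preserves the
-- orbit partition (N ⊴ G), the ends of every 2-geodesic lie in adjacent orbits. Hence the
-- vertices in, or adjacent to, the orbit of a fixed u are closed under taking neighbours,
-- and by connectivity every other orbit is adjacent to the orbit of u.
module Submission where

open import Defs
open import Data.Nat using (ℕ)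
open import Level using (0ℓ)
open import Data.Fin using (Fin)
open import Data.Fin.Properties using (_≟_)
open import Data.Product using (_×_; _,_; ∃; proj₁; proj₂)
open import Data.Sum using (_⊎_; inj₁; inj₂)
open import Data.Empty using (⊥-elim)
open import Relation.Nullary using (¬_; yes; no)
open import Relation.Unary using (Pred)
open import Function.Bundles using (_⇔_; mk⇔)
open import Relation.Binary.PropositionalEquality using (_≡_; refl; sym; trans; cong; subst)

module _ {n : ℕ} (Γ : Graph n) (N : Pred (Perm n) 0ℓ) where
  open Quotient Γ N

  OrbitEdge : Fin n → Fin n → Set
  OrbitEdge u v = ∃ λ u' → ∃ λ v' → SameOrbit u u' × SameOrbit v v' × _~_ Γ u' v'

  OrbitEdge-sym : ∀ {u v} → OrbitEdge u v → OrbitEdge v u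
  OrbitEdge-sym (u' , v' , uu' , vv' , u'v') = v' , u' , vv' , uu' , ~-sym Γ u'v'

  InOrOnOrbit : Fin n → Fin n → Set
  InOrOnOrbit u v = SameOrbit u v ⊎ OrbitEdge u v

  module _ (N-subgroup : IsSubgroup N) where
    open IsSubgroup N-subgroup

    sameOrbit-refl : ∀ u → SameOrbit u u
    sameOrbit-refl u = idPerm , id-∈ , refl

    sameOrbit-sym : ∀ {u v} → SameOrbit u v → SameOrbit v u
    sameOrbit-sym {u} (g , g∈N , gu≡v) =
      g ⁻¹ₚ , ⁻¹-∈ g∈N , trans (cong (from g) (sym gu≡v)) (from-to g u)

    sameOrbit-trans : ∀ {u v w} → SameOrbit u v → SameOrbit v w → SameOrbit u w
    sameOrbit-trans (g , g∈N , gu≡v) (h , h∈N , hv≡w) =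
      h ∘ₚ g , ∘-∈ h∈N g∈N , trans (cong (to h) gu≡v) hv≡w

    OrbitEdge-resp : ∀ {u u₂ v v₂} → SameOrbit u u₂ → SameOrbit v v₂ →
                     OrbitEdge u v → OrbitEdge u₂ v₂
    OrbitEdge-resp uu₂ vv₂ (u' , v' , uu' , vv' , u'v') =
      u' , v' , sameOrbit-trans (sameOrbit-sym uu₂) uu' ,
      sameOrbit-trans (sameOrbit-sym vv₂) vv' , u'v'

    module _ (N-aut : ∀ g → N g → IsAut Γ g) where

      OrbitEdge⇒neighbourInOrbit : ∀ {u v} → OrbitEdge u v →
                                   ∃ λ u' → SameOrbit u u' × _~_ Γ u' v
      OrbitEdge⇒neighbourInOrbit {u} {v} (u' , v' , uu' , (g , g∈N , gv≡v') , u'v') =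
        from g u' , sameOrbit-trans uu' (g ⁻¹ₚ , ⁻¹-∈ g∈N , refl) ,
        subst (_~_ Γ (from g u')) g⁻¹v'≡v (proj₁ (N-aut (g ⁻¹ₚ) (⁻¹-∈ g∈N) u' v') u'v')
        where
        g⁻¹v'≡v : from g v' ≡ v
        g⁻¹v'≡v = trans (cong (from g) (sym gv≡v')) (from-to g v)

      quotientTriangle⇒2GeodesicOnOrbitEdge : TriangleFree Γ → QuotientGirth3 →
        ∃ λ a → ∃ λ b → ∃ λ c → Is2Geodesic Γ a b c × OrbitEdge a c
      quotientTriangle⇒2GeodesicOnOrbitEdge triangleFree
        (_ , b , _ , (_ , ub) , (_ , bw) , (w≁u , wu))
        with OrbitEdge⇒neighbourInOrbit ub | OrbitEdge⇒neighbourInOrbit (OrbitEdge-sym bw)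
      ... | a , ua , ab | c , wc , cb =
        a , b , c , (ab , ~-sym Γ cb , a≢c , a≁c) , OrbitEdge-resp ua wc (OrbitEdge-sym wu)
        where
        a≢c : ¬ (a ≡ c)
        a≢c refl = w≁u (sameOrbit-trans wc (sameOrbit-sym ua))
        a≁c : ¬ (_~_ Γ a c)
        a≁c ac = triangleFree a b c ab (~-sym Γ cb) (~-sym Γ ac)

      module _ (2geodesic-onOrbitEdge : ∀ x y z → Is2Geodesic Γ x y z → OrbitEdge x z) where

        InOrOnOrbit-step : ∀ {u v w} → InOrOnOrbit u v → _~_ Γ v w → InOrOnOrbit u w
        InOrOnOrbit-step {v = v} {w} (inj₁ uv) vw = inj₂ (v , w , uv , sameOrbit-refl w , vw)
        InOrOnOrbit-step {v = v} {w} (inj₂ uv) vw with OrbitEdge⇒neighbourInOrbit uv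
        ... | u' , uu' , u'v with u' ≟ w
        ...   | yes refl = inj₁ uu'
        ...   | no u'≢w with ~-dec Γ u' w
        ...     | yes u'w = inj₂ (u' , w , uu' , sameOrbit-refl w , u'w)
        ...     | no u'≁w = inj₂ (OrbitEdge-resp (sameOrbit-sym uu') (sameOrbit-refl w)
                                   (2geodesic-onOrbitEdge u' v w (u'v , vw , u'≢w , u'≁w)))

        InOrOnOrbit-walk : ∀ {u v w} → Walk Γ v w → InOrOnOrbit u v → InOrOnOrbit u w
        InOrOnOrbit-walk here r = r
        InOrOnOrbit-walk (step vv' walk) r = InOrOnOrbit-walk walk (InOrOnOrbit-step r vv')

        connected⇒quotientComplete : Connected Γ → QuotientComplete
        connected⇒quotientComplete connected u v u≁v
          with InOrOnOrbit-walk (connected u v) (inj₁ (sameOrbit-refl u))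
        ... | inj₁ uv = ⊥-elim (u≁v uv)
        ... | inj₂ uv = u≁v , uv

module _ {n : ℕ} (Γ : Graph n) {G N : Pred (Perm n) 0ℓ}
         (G-aut : ∀ g → G g → IsAut Γ g) (N⊴G : IsNormalSubgroup N G) where
  open Quotient Γ N

  sameOrbit-image : ∀ {g} → G g → ∀ {u v} → SameOrbit u v → SameOrbit (to g u) (to g v)
  sameOrbit-image {g} g∈G {u} (h , h∈N , hu≡v) =
    (g ∘ₚ h) ∘ₚ (g ⁻¹ₚ) , proj₂ (proj₂ N⊴G) g∈G h∈N ,
    cong (to g) (trans (cong (to h) (from-to g u)) hu≡v)

  OrbitEdge-image : ∀ {g} → G g → ∀ {u v} → OrbitEdge Γ N u v →
                    OrbitEdge Γ N (to g u) (to g v)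
  OrbitEdge-image {g} g∈G (u' , v' , uu' , vv' , u'v') =
    to g u' , to g v' , sameOrbit-image g∈G uu' , sameOrbit-image g∈G vv' ,
    proj₁ (G-aut g g∈G u' v') u'v'

  2geodesicTransitive⇒all2GeodesicsOnOrbitEdges : Is2GeodesicTransitive Γ G →
    ∀ {a b c} → Is2Geodesic Γ a b c → OrbitEdge Γ N a c →
    ∀ x y z → Is2Geodesic Γ x y z → OrbitEdge Γ N x z
  2geodesicTransitive⇒all2GeodesicsOnOrbitEdges (_ , _ , _ , transitive)
    {a} {b} {c} abc ac x y z xyz
    with transitive a b c x y z abc xyz
  ... | g , g∈G , refl , _ , refl = OrbitEdge-image g∈G ac

lemma3p3 : (n : ℕ) (Γ : Graph n) (G N : Pred (Perm n) 0ℓ) →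
    IsSubgroup G → (∀ g → G g → IsAut Γ g) →
    Connected Γ → Is2GeodesicTransitive Γ G → TriangleFree Γ →
    IsNormalSubgroup N G →
    Quotient.Intransitive Γ N → Quotient.AtLeast3Orbits Γ N →
    (Quotient.QuotientComplete Γ N ⇔ Quotient.QuotientGirth3 Γ N)
lemma3p3 n Γ G N _ G-aut connected transitive triangleFree N⊴G _
         (u , v , w , u≁v , v≁w , u≁w) =
  mk⇔ complete⇒triangle triangle⇒complete
  where
  N-subgroup : IsSubgroup N
  N-subgroup = proj₁ N⊴G
  N-aut : ∀ g → N g → IsAut Γ g
  N-aut g g∈N = G-aut g (proj₁ (proj₂ N⊴G) g∈N)

  complete⇒triangle : Quotient.QuotientComplete Γ N → Quotient.QuotientGirth3 Γ N
  complete⇒triangle complete =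
    u , v , w , complete u v u≁v , complete v w v≁w ,
    complete w u (λ wu → u≁w (sameOrbit-sym Γ N N-subgroup wu))

  triangle⇒complete : Quotient.QuotientGirth3 Γ N → Quotient.QuotientComplete Γ N
  triangle⇒complete triangle
    with quotientTriangle⇒2GeodesicOnOrbitEdge Γ N N-subgroup N-aut triangleFree triangle
  ... | a , b , c , abc , ac =
    connected⇒quotientComplete Γ N N-subgroup N-aut
      (2geodesicTransitive⇒all2GeodesicsOnOrbitEdges Γ G-aut N⊴G transitive abc ac) connected
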